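{- For integers $k\ge1$ and $N\ge k+1$, $$T_2(N,k)=\theta^{2N-2k}P_kP_{k-1}(P_{N-2})!+\sum_{i=k+1}^{N}\theta^{2N-2i}B(i-2,N-i)\,T_2(i-1,k)\,(P_{N-i})!,$$ where $T_2(k,k)=(P_k)!$.
   Context: Let $\theta>0$. $\mathrm{inv}(\pi)$ is the number of pairs $i<j$ with $\pi_i>\pi_j$. $P_n=1+\theta+\cdots+\theta^{n-1}$ ($P_0=0$), $(P_n)!=P_nP_{n-1}\cdots P_1$, $(P_0)!=1$. $B(n,m)=\sum\theta^{\#\{(a,b):a\in\Pi_1,b\in\Pi_2,a>b\}}$ over all ordered partitions $(\Pi_1,\Pi_2)$ of $\{1,\dots,n+m\}$ with $|\Pi_1|=n,|\Pi_2|=m$. For $\pi\in S_n$, position $i$ is a left-to-right second maximum if exactly one $j<i$ has $\pi_j>\pi_i$. The strategy $S^2_k$ rejects the first $k$ candidates and then accepts the next left-to-right second maximum; $\pi$ is $k$-pickable if $S^2_k$ makes a selection on $\pi$, i.e. some position $i>k$ is a left-to-right second maximum. $T_2(n,k)=\sum_{\pi\in S_n\text{ not }k\text{ -pickable}}\theta^{\mathrm{inv}(\pi)}$. -}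

module Defs where

open import Algebra.Bundles using (CommutativeSemiring)
open import Data.Bool using (Bool; true; false; if_then_else_; not; _∨_)
open import Data.List using (List; []; _∷_; map; concatMap; _++_; length; filter; drop; foldr; upTo)
open import Data.Nat using (ℕ; zero; suc; _+_; _∸_; _<?_; _≟_)
open import Relation.Nullary.Decidable using (⌊_⌋)

insertAll : ℕ → List ℕ → List (List ℕ)
insertAll x [] = (x ∷ []) ∷ []
insertAll x (y ∷ ys) = (x ∷ y ∷ ys) ∷ map (y ∷_) (insertAll x ys)

perms : ℕ → List (List ℕ)
perms zero = [] ∷ []
perms (suc n) = concatMap (insertAll (suc n)) (perms n)

countGreater : ℕ → List ℕ → ℕ
countGreater x xs = length (filter (λ y → x <? y) xs)

countSmaller : ℕ → List ℕ → ℕ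
countSmaller x xs = length (filter (λ y → y <? x) xs)

inv : List ℕ → ℕ
inv [] = 0
inv (x ∷ xs) = countSmaller x xs + inv xs

-- flags: the i-th entry (1-indexed) is true iff position i is a
-- left-to-right second maximum, i.e. exactly one earlier entry exceeds π_i.
secondMaxFlags : List ℕ → List ℕ → List Bool
secondMaxFlags seen [] = []
secondMaxFlags seen (x ∷ xs) = ⌊ countGreater x seen ≟ 1 ⌋ ∷ secondMaxFlags (x ∷ seen) xs

or : List Bool → Bool
or = foldr _∨_ false

-- π is k-pickable iff some position i > k is a left-to-right second maximum
pickable : ℕ → List ℕ → Bool
pickable k π = or (drop k (secondMaxFlags [] π))

-- all Boolean lists of length L; a list bs encodes the subset
-- Π₁ = { j+1 : bs[j] = true } of {1,…,L}, Π₂ its complement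
bools : ℕ → List (List Bool)
bools zero = [] ∷ []
bools (suc L) = map (true ∷_) (bools L) ++ map (false ∷_) (bools L)

countTrue : List Bool → ℕ
countTrue [] = 0
countTrue (true ∷ bs) = suc (countTrue bs)
countTrue (false ∷ bs) = countTrue bs

-- #{(a,b) : a ∈ Π₁, b ∈ Π₂, a > b}
crossings : List Bool → ℕ
crossings [] = 0
crossings (true ∷ bs) = crossings bs
crossings (false ∷ bs) = countTrue bs + crossings bs

-- the integers lo, lo+1, …, hi (empty if hi < lo)
range : ℕ → ℕ → List ℕ
range lo hi = map (lo +_) (upTo (suc hi ∸ lo))

module WithSemiring {c ℓ} (R : CommutativeSemiring c ℓ) where
  open CommutativeSemiring R public using (Carrier; _≈_; 0#; 1#) renaming (_+_ to _⊕_; _*_ to _⊗_)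

  sumL : List Carrier → Carrier
  sumL = foldr _⊕_ 0#

  pow : Carrier → ℕ → Carrier
  pow θ zero = 1#
  pow θ (suc n) = θ ⊗ pow θ n

  P : Carrier → ℕ → Carrier
  P θ zero = 0#
  P θ (suc n) = pow θ n ⊕ P θ n

  Pfact : Carrier → ℕ → Carrier
  Pfact θ zero = 1#
  Pfact θ (suc n) = P θ (suc n) ⊗ Pfact θ n

  B : Carrier → ℕ → ℕ → Carrier
  B θ n m = sumL (map (λ bs → if ⌊ countTrue bs ≟ n ⌋ then pow θ (crossings bs) else 0#)
                      (bools (n + m)))

  T2 : Carrier → ℕ → ℕ → Carrier
  T2 θ n k = sumL (map (λ π → if pickable k π then 0# else pow θ (inv π)) (perms n))

-- A permutation is encoded by its code, listing for each position how many earlier entries are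
-- larger: records are the positions of code 0 and second maxima those of code 1. Inserting the
-- maximum n at position q adds n - q inversions, gives code 0 there and raises every later code
-- by one, so sums over S_n become sums over the position i of the maximum N. If i ≤ k, π is
-- unpickable iff the other entries have no record after position k - 1, i.e. N - 1 is among their
-- first k - 1 entries; this is the first term. If i > k, no entry after N may be a record of the
-- others, so N - 1 precedes N, and the first i - 1 entries must be unpickable. A weight depending
-- only on the pattern of the first r entries of a permutation of size r + m factors as B(r, m) (P_m)!
-- times its sum over S_r (choice of the values in the prefix, free suffix); with r = i - 2 and the
-- inversions of N and N - 1 over the suffix this gives θ^(2N-2i) B(i-2, N-i) T_2(i-1, k) (P_{N-i})!.
module Submission where

open import Defs
open import Algebra.Bundles using (CommutativeSemiring)
open import Data.List using (map)
open import Data.Nat using (ℕ; _≤_; _+_; _*_; _∸_)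
open import Data.Product using (_×_)
open import Data.Product using (_,_)
open import Data.Nat using (zero; suc; s≤s)
import Data.Nat.Properties as ℕ
open import Relation.Nullary using (contradiction)
import Relation.Binary.PropositionalEquality as ≡

module NatArithmetic where

  open import Data.Nat using (_<_)
  open import Data.Nat.Properties using (m∸n+n≡m; +-∸-assoc; m+[n∸m]≡n; +-monoʳ-<)
  open import Relation.Binary.PropositionalEquality using (_≡_; cong; sym; trans; subst)

  ∸-split : ∀ {a b c} → a ≤ b → b ≤ c → c ∸ a ≡ (c ∸ b) + (b ∸ a)
  ∸-split {a} a≤b b≤c = trans (cong (_∸ a) (sym (m∸n+n≡m b≤c))) (+-∸-assoc _ a≤b)

  j<n∸m⇒m+j<n : ∀ {m n} j → m ≤ n → j < n ∸ m → m + j < n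
  j<n∸m⇒m+j<n {m} j m≤n j<n∸m = subst (m + j <_) (m+[n∸m]≡n m≤n) (+-monoʳ-< m j<n∸m)

module PermutationCodes where

  open import Data.Bool using (Bool; true; false; _∨_)
  open import Data.Bool.Properties using (∨-assoc; ∨-zeroʳ)
  open import Data.List using (List; []; _∷_; _++_; length; take; drop; filter; map; applyUpTo)
  open import Data.Bool.ListAction using (any)
  open import Data.List.Properties
    using (map-applyUpTo; filter-accept; filter-reject; filter-all; filter-none; take-map; drop-map; drop-all)
  open import Data.List.Relation.Unary.All using (All; []; _∷_) renaming (map to All-map)
  open import Data.List.Relation.Unary.All.Properties using (map⁺; concat⁺; applyUpTo⁺₁)
  open import Data.Nat using (ℕ; zero; suc; _+_; _∸_; _<_; _≤_; z≤n; s≤s; _<?_; _≟_)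
  open import Data.Nat.Properties using (<⇒≯; ≤-refl; m<n⇒m<1+n; +-comm; +-assoc)
  open import Data.Product using (_×_; _,_)
  open import Relation.Binary.PropositionalEquality
  open import Relation.Nullary using (¬_)
  open import Relation.Nullary.Decidable using (⌊_⌋; does)
  open import Relation.Unary using (Decidable; ∁)

  insertAt : ℕ → ℕ → List ℕ → List ℕ
  insertAt zero x ys = x ∷ ys
  insertAt (suc q) x [] = x ∷ []
  insertAt (suc q) x (y ∷ ys) = y ∷ insertAt q x ys

  length-insertAt : ∀ q x ys → length (insertAt q x ys) ≡ suc (length ys)
  length-insertAt zero x ys = refl
  length-insertAt (suc q) x [] = refl
  length-insertAt (suc q) x (y ∷ ys) = cong suc (length-insertAt q x ys)

  All-insertAt : ∀ {P : ℕ → Set} q {x} ys → P x → All P ys → All P (insertAt q x ys)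
  All-insertAt zero ys px pys = px ∷ pys
  All-insertAt (suc q) [] px pys = px ∷ []
  All-insertAt (suc q) (y ∷ ys) px (py ∷ pys) = py ∷ All-insertAt q ys px pys

  module _ {P : ℕ → Set} (P? : Decidable P) where

    length-filter-middle : ∀ {x} as bs → P x →
                           length (filter P? (as ++ x ∷ bs)) ≡ suc (length (filter P? (as ++ bs)))
    length-filter-middle [] bs px = cong length (filter-accept P? px)
    length-filter-middle (a ∷ as) bs px with does (P? a)
    ... | true = cong suc (length-filter-middle as bs px)
    ... | false = length-filter-middle as bs px

    length-filter-insertAt : ∀ {x} q ys → ¬ P x → length (filter P? (insertAt q x ys)) ≡ length (filter P? ys)
    length-filter-insertAt zero ys ¬px = cong length (filter-reject P? ¬px)
    length-filter-insertAt (suc q) [] ¬px = cong length (filter-reject P? ¬px)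
    length-filter-insertAt (suc q) (y ∷ ys) ¬px with does (P? y)
    ... | true = cong suc (length-filter-insertAt q ys ¬px)
    ... | false = length-filter-insertAt q ys ¬px

    length-filter-all : ∀ {xs} → All P xs → length (filter P? xs) ≡ length xs
    length-filter-all pxs = cong length (filter-all P? pxs)

    length-filter-none : ∀ {xs} → All (∁ P) xs → length (filter P? xs) ≡ 0
    length-filter-none ¬pxs = cong length (filter-none P? ¬pxs)

  greaterCounts : List ℕ → List ℕ → List ℕ
  greaterCounts seen [] = []
  greaterCounts seen (x ∷ xs) = countGreater x seen ∷ greaterCounts (x ∷ seen) xs

  code : List ℕ → List ℕ
  code = greaterCounts []

  length-greaterCounts : ∀ seen xs → length (greaterCounts seen xs) ≡ length xs
  length-greaterCounts seen [] = refl
  length-greaterCounts seen (x ∷ xs) = cong suc (length-greaterCounts (x ∷ seen) xs)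

  isZero isOne : ℕ → Bool
  isZero c = ⌊ c ≟ 0 ⌋
  isOne c = ⌊ c ≟ 1 ⌋

  pickableCode : ℕ → List ℕ → Bool
  pickableCode k c = any isOne (drop k c)

  recordAfter : ℕ → List ℕ → Bool
  recordAfter q c = any isZero (drop q c)

  secondMaxFlags≡map-isOne : ∀ seen xs → secondMaxFlags seen xs ≡ map isOne (greaterCounts seen xs)
  secondMaxFlags≡map-isOne seen [] = refl
  secondMaxFlags≡map-isOne seen (x ∷ xs) = cong (_ ∷_) (secondMaxFlags≡map-isOne (x ∷ seen) xs)

  pickable≡pickableCode : ∀ k π → pickable k π ≡ pickableCode k (code π)
  pickable≡pickableCode k π =
    trans (cong (λ flags → or (drop k flags)) (secondMaxFlags≡map-isOne [] π)) (cong or (drop-map k (code π)))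

  insertAll≡applyUpTo-insertAt : ∀ x ys → insertAll x ys ≡ applyUpTo (λ q → insertAt q x ys) (suc (length ys))
  insertAll≡applyUpTo-insertAt x [] = refl
  insertAll≡applyUpTo-insertAt x (y ∷ ys) = cong ((x ∷ y ∷ ys) ∷_)
    (trans (cong (map (y ∷_)) (insertAll≡applyUpTo-insertAt x ys))
           (map-applyUpTo (λ q → insertAt q x ys) (y ∷_) (suc (length ys))))

  Bounded : ℕ → List ℕ → Set
  Bounded n π = length π ≡ n × All (_< suc n) π

  perms-bounded : ∀ n → All (Bounded n) (perms n)
  perms-bounded zero = (refl , []) ∷ []
  perms-bounded (suc n) = concat⁺ (map⁺ (All-map insertions-bounded (perms-bounded n)))
    where
    insertions-bounded : ∀ {π} → Bounded n π → All (Bounded (suc n)) (insertAll (suc n) π)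
    insertions-bounded {π} (refl , π<) rewrite insertAll≡applyUpTo-insertAt (suc n) π =
      applyUpTo⁺₁ _ (suc n) (λ {q} _ → length-insertAt q (suc n) π , All-insertAt q π ≤-refl (All-map m<n⇒m<1+n π<))

  insertMaxCode : ℕ → List ℕ → List ℕ
  insertMaxCode zero c = 0 ∷ map suc c
  insertMaxCode (suc q) [] = 0 ∷ []
  insertMaxCode (suc q) (c₀ ∷ c) = c₀ ∷ insertMaxCode q c

  countGreater-below : ∀ {x} seen → All (_< x) seen → countGreater x seen ≡ 0
  countGreater-below {x} seen ps = length-filter-none (x <?_) (All-map <⇒≯ ps)

  greaterCounts-insertLarger : ∀ {x} as bs ys → All (_< x) ys →
                               greaterCounts (as ++ x ∷ bs) ys ≡ map suc (greaterCounts (as ++ bs) ys)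
  greaterCounts-insertLarger as bs [] [] = refl
  greaterCounts-insertLarger as bs (y ∷ ys) (p ∷ ps) =
    cong₂ _∷_ (length-filter-middle (y <?_) as bs p) (greaterCounts-insertLarger (y ∷ as) bs ys ps)

  greaterCounts-insertAt : ∀ {x} q seen xs → All (_< x) seen → All (_< x) xs →
                           greaterCounts seen (insertAt q x xs) ≡ insertMaxCode q (greaterCounts seen xs)
  greaterCounts-insertAt zero seen xs ps qs =
    cong₂ _∷_ (countGreater-below seen ps) (greaterCounts-insertLarger [] seen xs qs)
  greaterCounts-insertAt (suc q) seen [] ps qs = cong (_∷ []) (countGreater-below seen ps)
  greaterCounts-insertAt (suc q) seen (y ∷ ys) ps (p ∷ qs) =
    cong (_ ∷_) (greaterCounts-insertAt q (y ∷ seen) ys (p ∷ ps) qs)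

  inv-insertAt : ∀ {x} q xs → All (_< x) xs → inv (insertAt q x xs) ≡ inv xs + (length xs ∸ q)
  inv-insertAt {x} zero xs ps = trans (cong (_+ inv xs) (length-filter-all (_<? x) ps)) (+-comm (length xs) (inv xs))
  inv-insertAt (suc q) [] ps = refl
  inv-insertAt (suc q) (y ∷ ys) (p ∷ ps) =
    trans (cong₂ _+_ (length-filter-insertAt (_<? y) q ys (<⇒≯ p)) (inv-insertAt q ys ps))
          (sym (+-assoc (countSmaller y ys) (inv ys) _))

  any-isZero-map-suc : ∀ c → any isZero (map suc c) ≡ false
  any-isZero-map-suc [] = refl
  any-isZero-map-suc (x ∷ c) = any-isZero-map-suc c

  any-isOne-map-suc : ∀ c → any isOne (map suc c) ≡ any isZero c
  any-isOne-map-suc [] = refl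
  any-isOne-map-suc (zero ∷ c) = refl
  any-isOne-map-suc (suc x ∷ c) = any-isOne-map-suc c

  any-isZero-insertMaxCode : ∀ q c → any isZero (insertMaxCode q c) ≡ true
  any-isZero-insertMaxCode zero c = refl
  any-isZero-insertMaxCode (suc q) [] = refl
  any-isZero-insertMaxCode (suc q) (x ∷ c) =
    trans (cong (isZero x ∨_) (any-isZero-insertMaxCode q c)) (∨-zeroʳ (isZero x))

  recordAfter-insertMaxCode-before : ∀ q′ q c → q′ < q → recordAfter q (insertMaxCode q′ c) ≡ false
  recordAfter-insertMaxCode-before zero (suc q) c _ =
    trans (cong (any isZero) (drop-map q c)) (any-isZero-map-suc (drop q c))
  recordAfter-insertMaxCode-before (suc q′) (suc (suc q)) [] _ = refl
  recordAfter-insertMaxCode-before (suc q′) (suc q) (x ∷ c) (s≤s q′<q) = recordAfter-insertMaxCode-before q′ q c q′<q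

  recordAfter-insertMaxCode-after : ∀ q q′ c → q ≤ q′ → q′ ≤ length c →
                                    recordAfter q (insertMaxCode q′ c) ≡ true
  recordAfter-insertMaxCode-after zero q′ c _ _ = any-isZero-insertMaxCode q′ c
  recordAfter-insertMaxCode-after (suc q) (suc q′) (x ∷ c) (s≤s q≤q′) (s≤s q′≤∣c∣) =
    recordAfter-insertMaxCode-after q q′ c q≤q′ q′≤∣c∣

  pickableCode-insertMaxCode-early : ∀ q k c → q ≤ k → pickableCode (suc k) (insertMaxCode q c) ≡ recordAfter k c
  pickableCode-insertMaxCode-early zero k c _ = trans (cong (any isOne) (drop-map k c)) (any-isOne-map-suc (drop k c))
  pickableCode-insertMaxCode-early (suc q) (suc k) [] _ = refl
  pickableCode-insertMaxCode-early (suc q) (suc k) (x ∷ c) (s≤s q≤k) = pickableCode-insertMaxCode-early q k c q≤k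

  pickableCode-insertMaxCode-late : ∀ k q c → k ≤ q → q ≤ length c →
                                    pickableCode k (insertMaxCode q c) ≡ pickableCode k (take q c) ∨ recordAfter q c
  pickableCode-insertMaxCode-late zero zero c _ _ = any-isOne-map-suc c
  pickableCode-insertMaxCode-late zero (suc q) (x ∷ c) _ (s≤s q≤∣c∣) =
    trans (cong (isOne x ∨_) (pickableCode-insertMaxCode-late zero q c z≤n q≤∣c∣)) (sym (∨-assoc (isOne x) _ _))
  pickableCode-insertMaxCode-late (suc k) (suc q) (x ∷ c) (s≤s k≤q) (s≤s q≤∣c∣) =
    pickableCode-insertMaxCode-late k q c k≤q q≤∣c∣

  pickableCode-short : ∀ k c → length c ≤ k → pickableCode k c ≡ false
  pickableCode-short k c ∣c∣≤k = cong (any isOne) (drop-all k c ∣c∣≤k)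

  take-insertMaxCode : ∀ q r c → q ≤ r → take (suc r) (insertMaxCode q c) ≡ insertMaxCode q (take r c)
  take-insertMaxCode zero r c _ = cong (0 ∷_) (take-map r c)
  take-insertMaxCode (suc q) (suc r) [] _ = refl
  take-insertMaxCode (suc q) (suc r) (x ∷ c) (s≤s q≤r) = cong (x ∷_) (take-insertMaxCode q r c q≤r)

  take-insertMaxCode-prefix : ∀ r q c → r ≤ q → q ≤ length c → take r (insertMaxCode q c) ≡ take r c
  take-insertMaxCode-prefix zero q c _ _ = refl
  take-insertMaxCode-prefix (suc r) (suc q) (x ∷ c) (s≤s r≤q) (s≤s q≤∣c∣) =
    cong (x ∷_) (take-insertMaxCode-prefix r q c r≤q q≤∣c∣)

module Interleavings where

  open import Data.Bool using (Bool; true; false)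
  open import Data.List using (List; []; _∷_; _++_; length)
  open import Data.List.Relation.Unary.All using (All; []; _∷_) renaming (map to All-map)
  open import Data.List.Relation.Unary.All.Properties using (map⁺; ++⁺)
  open import Data.Nat using (_≟_)
  open import Data.Nat.Properties using (+-assoc; +-suc)
  open import Relation.Binary.PropositionalEquality
  open import Relation.Nullary.Decidable using (⌊_⌋; isYes≗does)

  does-suc≟suc : ∀ a b → ⌊ suc a ≟ suc b ⌋ ≡ ⌊ a ≟ b ⌋
  does-suc≟suc a b = trans (isYes≗does (suc a ≟ suc b)) (sym (isYes≗does (a ≟ b)))

  countFalse : List Bool → ℕ
  countFalse [] = 0
  countFalse (true ∷ bs) = countFalse bs
  countFalse (false ∷ bs) = suc (countFalse bs)

  countTrue+countFalse : ∀ bs → countTrue bs + countFalse bs ≡ length bs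
  countTrue+countFalse [] = refl
  countTrue+countFalse (true ∷ bs) = cong suc (countTrue+countFalse bs)
  countTrue+countFalse (false ∷ bs) = trans (+-suc (countTrue bs) (countFalse bs)) (cong suc (countTrue+countFalse bs))

  countTrue-∷ʳ-true : ∀ bs → countTrue (bs ++ true ∷ []) ≡ suc (countTrue bs)
  countTrue-∷ʳ-true [] = refl
  countTrue-∷ʳ-true (true ∷ bs) = cong suc (countTrue-∷ʳ-true bs)
  countTrue-∷ʳ-true (false ∷ bs) = countTrue-∷ʳ-true bs

  countTrue-∷ʳ-false : ∀ bs → countTrue (bs ++ false ∷ []) ≡ countTrue bs
  countTrue-∷ʳ-false [] = refl
  countTrue-∷ʳ-false (true ∷ bs) = cong suc (countTrue-∷ʳ-false bs)
  countTrue-∷ʳ-false (false ∷ bs) = countTrue-∷ʳ-false bs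

  crossings-∷ʳ-false : ∀ bs → crossings (bs ++ false ∷ []) ≡ crossings bs
  crossings-∷ʳ-false [] = refl
  crossings-∷ʳ-false (true ∷ bs) = crossings-∷ʳ-false bs
  crossings-∷ʳ-false (false ∷ bs) = cong₂ _+_ (countTrue-∷ʳ-false bs) (crossings-∷ʳ-false bs)

  crossings-∷ʳ-true : ∀ bs → crossings (bs ++ true ∷ []) ≡ crossings bs + countFalse bs
  crossings-∷ʳ-true [] = refl
  crossings-∷ʳ-true (true ∷ bs) = crossings-∷ʳ-true bs
  crossings-∷ʳ-true (false ∷ bs) = begin
    countTrue (bs ++ true ∷ []) + crossings (bs ++ true ∷ [])
      ≡⟨ cong₂ _+_ (countTrue-∷ʳ-true bs) (crossings-∷ʳ-true bs) ⟩
    suc (countTrue bs) + (crossings bs + countFalse bs)   ≡⟨ cong suc (sym (+-assoc (countTrue bs) _ _)) ⟩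
    suc (countTrue bs + crossings bs + countFalse bs)     ≡⟨ sym (+-suc _ (countFalse bs)) ⟩
    countTrue bs + crossings bs + suc (countFalse bs)     ∎
    where open ≡-Reasoning

  bools-length : ∀ L → All (λ bs → length bs ≡ L) (bools L)
  bools-length zero = refl ∷ []
  bools-length (suc L) = ++⁺ (map⁺ (All-map (cong suc) (bools-length L))) (map⁺ (All-map (cong suc) (bools-length L)))

open NatArithmetic
open PermutationCodes
open Interleavings

module WeightedSums {c ℓ} (R : CommutativeSemiring c ℓ) (θ : CommutativeSemiring.Carrier R) where
  open WithSemiring R
  open CommutativeSemiring R
    using (refl; sym; trans; reflexive; setoid; +-cong; *-cong; +-identityˡ; +-identityʳ; +-assoc; +-comm;
           *-identityˡ; *-identityʳ; *-assoc; *-comm; zeroˡ; zeroʳ; distribˡ)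
  open import Algebra.Solver.Ring.NaturalCoefficients.Default R using (solve; _:=_; _:+_; _:*_)
  open import Data.Bool using (Bool; true; false; if_then_else_; _∨_)
  open import Data.List using (List; []; _∷_; _++_; length; take; map; concatMap; applyUpTo)
  open import Data.List.Properties using (map-applyUpTo; take-all)
  open import Data.List.Relation.Unary.All using (All; []; _∷_) renaming (map to All-map)
  open import Data.Nat using (zero; suc; _<_; z≤n; s≤s; _≟_)
  open import Relation.Nullary.Decidable using (Dec; yes; no; ⌊_⌋)
  import Data.Nat.Properties as ℕ
  open import Data.Product using (_,_)
  import Relation.Binary.PropositionalEquality as ≡
  open ≡ using (_≡_)
  open import Relation.Binary.Reasoning.Setoid setoid

  ∑ : {A : Set} → List A → (A → Carrier) → Carrier
  ∑ xs f = sumL (map f xs)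

  ∑< : ℕ → (ℕ → Carrier) → Carrier
  ∑< n f = sumL (applyUpTo f n)

  infix 5 ∑ ∑<
  syntax ∑ xs (λ x → e) = ∑[ x ← xs ] e
  syntax ∑< n (λ q → e) = ∑[ q < n ] e

  ∑-++ : ∀ {A : Set} (xs ys : List A) f → ∑ (xs ++ ys) f ≈ ∑ xs f ⊕ ∑ ys f
  ∑-++ [] ys f = sym (+-identityˡ _)
  ∑-++ (x ∷ xs) ys f = trans (+-cong refl (∑-++ xs ys f)) (sym (+-assoc _ _ _))

  ∑-map : ∀ {A B : Set} (g : A → B) xs (f : B → Carrier) → ∑ (map g xs) f ≡ ∑[ x ← xs ] f (g x)
  ∑-map g [] f = ≡.refl
  ∑-map g (x ∷ xs) f = ≡.cong (f (g x) ⊕_) (∑-map g xs f)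

  ∑-applyUpTo : ∀ {A : Set} (g : ℕ → A) n (f : A → Carrier) → ∑ (applyUpTo g n) f ≡ ∑[ q < n ] f (g q)
  ∑-applyUpTo g n f = ≡.cong sumL (map-applyUpTo g f n)

  ∑-concatMap : ∀ {A B : Set} (g : A → List B) xs f → ∑ (concatMap g xs) f ≈ ∑[ x ← xs ] ∑ (g x) f
  ∑-concatMap g [] f = refl
  ∑-concatMap g (x ∷ xs) f = trans (∑-++ (g x) _ f) (+-cong refl (∑-concatMap g xs f))

  ∑-congᴬ : ∀ {A : Set} {xs : List A} {f g} → All (λ x → f x ≈ g x) xs → ∑ xs f ≈ ∑ xs g
  ∑-congᴬ [] = refl
  ∑-congᴬ (fx≈gx ∷ rest) = +-cong fx≈gx (∑-congᴬ rest)

  ∑-cong : ∀ {A : Set} (xs : List A) {f g} → (∀ x → f x ≈ g x) → ∑ xs f ≈ ∑ xs g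
  ∑-cong [] f≈g = refl
  ∑-cong (x ∷ xs) f≈g = +-cong (f≈g x) (∑-cong xs f≈g)

  ∑-zero : ∀ {A : Set} (xs : List A) → ∑ xs (λ _ → 0#) ≈ 0#
  ∑-zero [] = refl
  ∑-zero (x ∷ xs) = trans (+-identityˡ _) (∑-zero xs)

  ∑-⊕ : ∀ {A : Set} (xs : List A) f g → ∑[ x ← xs ] (f x ⊕ g x) ≈ ∑ xs f ⊕ ∑ xs g
  ∑-⊕ [] f g = sym (+-identityˡ _)
  ∑-⊕ (x ∷ xs) f g = trans (+-cong refl (∑-⊕ xs f g))
    (solve 4 (λ a b c d → a :+ b :+ (c :+ d) := a :+ c :+ (b :+ d)) refl _ _ _ _)

  ∑-distribˡ : ∀ {A : Set} (xs : List A) a f → ∑[ x ← xs ] (a ⊗ f x) ≈ a ⊗ ∑ xs f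
  ∑-distribˡ [] a f = sym (zeroʳ a)
  ∑-distribˡ (x ∷ xs) a f = trans (+-cong refl (∑-distribˡ xs a f)) (sym (distribˡ a _ _))

  ∑<-cong : ∀ n {f g} → (∀ q → q < n → f q ≈ g q) → ∑< n f ≈ ∑< n g
  ∑<-cong zero f≈g = refl
  ∑<-cong (suc n) f≈g = +-cong (f≈g 0 (s≤s z≤n)) (∑<-cong n (λ q q<n → f≈g (suc q) (s≤s q<n)))

  ∑<-zero : ∀ n → ∑[ q < n ] 0# ≈ 0#
  ∑<-zero zero = refl
  ∑<-zero (suc n) = trans (+-identityˡ _) (∑<-zero n)

  ∑<-distribˡ : ∀ n a f → ∑[ q < n ] (a ⊗ f q) ≈ a ⊗ ∑< n f
  ∑<-distribˡ zero a f = sym (zeroʳ a)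
  ∑<-distribˡ (suc n) a f = trans (+-cong refl (∑<-distribˡ n a (λ q → f (suc q)))) (sym (distribˡ a _ _))

  ∑<-+ : ∀ a b f → ∑< (a + b) f ≈ ∑< a f ⊕ (∑[ j < b ] f (a + j))
  ∑<-+ zero b f = sym (+-identityˡ _)
  ∑<-+ (suc a) b f = trans (+-cong refl (∑<-+ a b (λ q → f (suc q)))) (sym (+-assoc _ _ _))

  ∑<-split : ∀ {a n} f → a ≤ n → ∑< n f ≈ ∑< a f ⊕ (∑[ j < n ∸ a ] f (a + j))
  ∑<-split {a} {n} f a≤n =
    trans (reflexive (≡.cong (λ m → ∑< m f) (≡.sym (ℕ.m+[n∸m]≡n a≤n)))) (∑<-+ a (n ∸ a) f)

  ∑<-vanish : ∀ {a n} f → a ≤ n → (∀ q → a ≤ q → q < n → f q ≈ 0#) → ∑< n f ≈ ∑< a f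
  ∑<-vanish {a} {n} f a≤n f≈0 = begin
      ∑< n f
    ≈⟨ ∑<-split f a≤n ⟩
      ∑< a f ⊕ (∑[ j < n ∸ a ] f (a + j))
    ≈⟨ +-cong refl (trans (∑<-cong (n ∸ a) (λ j j< → f≈0 (a + j) (ℕ.m≤m+n a j) (j<n∸m⇒m+j<n j a≤n j<)))
                          (∑<-zero (n ∸ a))) ⟩
      ∑< a f ⊕ 0#
    ≈⟨ +-identityʳ _ ⟩
      ∑< a f
    ∎

  ∑-∑<-comm : ∀ {A : Set} (xs : List A) n (g : A → ℕ → Carrier) →
              ∑[ x ← xs ] ∑< n (g x) ≈ ∑[ q < n ] ∑[ x ← xs ] g x q
  ∑-∑<-comm xs zero g = ∑-zero xs
  ∑-∑<-comm xs (suc n) g =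
    trans (∑-⊕ xs (λ x → g x 0) (λ x → ∑< n (λ q → g x (suc q))))
          (+-cong refl (∑-∑<-comm xs n (λ x q → g x (suc q))))

  pow-+ : ∀ m n → pow θ (m + n) ≈ pow θ m ⊗ pow θ n
  pow-+ zero n = sym (*-identityˡ _)
  pow-+ (suc m) n = trans (*-cong refl (pow-+ m n)) (sym (*-assoc _ _ _))

  pow-2*∸2* : ∀ N k → pow θ (2 * N ∸ 2 * k) ≈ pow θ (N ∸ k) ⊗ pow θ (N ∸ k)
  pow-2*∸2* N k = trans (reflexive (≡.cong (pow θ) 2*N∸2*k≡)) (pow-+ (N ∸ k) (N ∸ k))
    where
    2*N∸2*k≡ : 2 * N ∸ 2 * k ≡ (N ∸ k) + (N ∸ k)
    2*N∸2*k≡ = ≡.trans (≡.sym (ℕ.*-distribˡ-∸ 2 N k)) (≡.cong ((N ∸ k) +_) (ℕ.+-identityʳ (N ∸ k)))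

  ∑<-pow : ∀ d a → ∑[ q < a ] pow θ (d + (a ∸ suc q)) ≈ pow θ d ⊗ P θ a
  ∑<-pow d zero = sym (zeroʳ _)
  ∑<-pow d (suc a) = trans (+-cong (pow-+ d a) (∑<-pow d a)) (sym (distribˡ _ _ _))

  ∑<-pow-∸ : ∀ n → ∑[ q < suc n ] pow θ (n ∸ q) ≈ P θ (suc n)
  ∑<-pow-∸ n = trans (∑<-pow 0 (suc n)) (*-identityˡ _)

  codeSum : ℕ → (List ℕ → Carrier) → Carrier
  codeSum n f = ∑[ π ← perms n ] f (code π) ⊗ pow θ (inv π)

  codeSum-cong : ∀ n {f g} → (∀ c → length c ≡ n → f c ≈ g c) → codeSum n f ≈ codeSum n g
  codeSum-cong n {f} {g} f≈g = ∑-congᴬ (All-map termwise (perms-bounded n))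
    where
    termwise : ∀ {π} → Bounded n π → f (code π) ⊗ pow θ (inv π) ≈ g (code π) ⊗ pow θ (inv π)
    termwise {π} (∣π∣≡n , _) = *-cong (f≈g (code π) (≡.trans (length-greaterCounts [] π) ∣π∣≡n)) refl

  codeSum-zero : ∀ f → codeSum 0 f ≈ f []
  codeSum-zero f = trans (+-identityʳ _) (*-identityʳ _)

  codeSum-suc : ∀ n f → codeSum (suc n) f ≈ ∑[ q < suc n ] pow θ (n ∸ q) ⊗ codeSum n (λ c → f (insertMaxCode q c))
  codeSum-suc n f = begin
      codeSum (suc n) f
    ≈⟨ ∑-concatMap (insertAll (suc n)) (perms n) F ⟩
      ∑[ π ← perms n ] ∑ (insertAll (suc n) π) F
    ≈⟨ ∑-congᴬ (All-map insertions (perms-bounded n)) ⟩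
      ∑[ π ← perms n ] ∑[ q < suc n ] pow θ (n ∸ q) ⊗ F′ q π
    ≈⟨ ∑-∑<-comm (perms n) (suc n) (λ π q → pow θ (n ∸ q) ⊗ F′ q π) ⟩
      ∑[ q < suc n ] ∑[ π ← perms n ] pow θ (n ∸ q) ⊗ F′ q π
    ≈⟨ ∑<-cong (suc n) (λ q _ → ∑-distribˡ (perms n) (pow θ (n ∸ q)) (F′ q)) ⟩
      ∑[ q < suc n ] pow θ (n ∸ q) ⊗ codeSum n (λ c → f (insertMaxCode q c))
    ∎
    where
    F : List ℕ → Carrier
    F π = f (code π) ⊗ pow θ (inv π)
    F′ : ℕ → List ℕ → Carrier
    F′ q π = f (insertMaxCode q (code π)) ⊗ pow θ (inv π)
    insertion : ∀ {π} q → Bounded n π → F (insertAt q (suc n) π) ≈ pow θ (n ∸ q) ⊗ F′ q π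
    insertion {π} q (≡.refl , π<) = begin
        F (insertAt q (suc n) π)
      ≈⟨ reflexive (≡.cong₂ (λ c i → f c ⊗ pow θ i)
                            (greaterCounts-insertAt q [] π [] π<) (inv-insertAt q π π<)) ⟩
        f (insertMaxCode q (code π)) ⊗ pow θ (inv π + (n ∸ q))
      ≈⟨ *-cong refl (pow-+ (inv π) (n ∸ q)) ⟩
        f (insertMaxCode q (code π)) ⊗ (pow θ (inv π) ⊗ pow θ (n ∸ q))
      ≈⟨ solve 3 (λ x y z → x :* (y :* z) := z :* (x :* y)) refl _ _ _ ⟩
        pow θ (n ∸ q) ⊗ F′ q π
      ∎
    insertions : ∀ {π} → Bounded n π → ∑ (insertAll (suc n) π) F ≈ ∑[ q < suc n ] pow θ (n ∸ q) ⊗ F′ q π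
    insertions {π} b@(≡.refl , _) =
      trans (reflexive (≡.trans (≡.cong (λ l → ∑ l F) (insertAll≡applyUpTo-insertAt (suc n) π))
                                (∑-applyUpTo (λ q → insertAt q (suc n) π) (suc n) F)))
            (∑<-cong (suc n) (λ q _ → insertion q b))

  codeSum-const : ∀ n a → codeSum n (λ _ → a) ≈ a ⊗ Pfact θ n
  codeSum-const zero a = trans (codeSum-zero (λ _ → a)) (sym (*-identityʳ a))
  codeSum-const (suc n) a = begin
      codeSum (suc n) (λ _ → a)
    ≈⟨ codeSum-suc n (λ _ → a) ⟩
      ∑[ q < suc n ] pow θ (n ∸ q) ⊗ codeSum n (λ _ → a)
    ≈⟨ ∑<-cong (suc n) (λ q _ → *-comm (pow θ (n ∸ q)) (codeSum n (λ _ → a))) ⟩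
      ∑[ q < suc n ] codeSum n (λ _ → a) ⊗ pow θ (n ∸ q)
    ≈⟨ ∑<-distribˡ (suc n) (codeSum n (λ _ → a)) (λ q → pow θ (n ∸ q)) ⟩
      codeSum n (λ _ → a) ⊗ (∑[ q < suc n ] pow θ (n ∸ q))
    ≈⟨ *-cong (codeSum-const n a) (∑<-pow-∸ n) ⟩
      a ⊗ Pfact θ n ⊗ P θ (suc n)
    ≈⟨ solve 3 (λ x y z → x :* y :* z := x :* (z :* y)) refl _ _ _ ⟩
      a ⊗ Pfact θ (suc n)
    ∎

  codeSum-0# : ∀ n → codeSum n (λ _ → 0#) ≈ 0#
  codeSum-0# n = trans (codeSum-const n 0#) (zeroˡ _)

  codeSum-1# : ∀ n → codeSum n (λ _ → 1#) ≈ Pfact θ n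
  codeSum-1# n = trans (codeSum-const n 1#) (*-identityˡ _)

  whenNot : Bool → Carrier
  whenNot b = if b then 0# else 1#

  whenNot-∨ : ∀ a b → whenNot (a ∨ b) ≈ whenNot a ⊗ whenNot b
  whenNot-∨ true b = sym (zeroˡ _)
  whenNot-∨ false b = sym (*-identityˡ _)

  T2≈codeSum : ∀ n k → T2 θ n k ≈ codeSum n (λ c → whenNot (pickableCode k c))
  T2≈codeSum n k = ∑-cong (perms n) term
    where
    if≈whenNot⊗ : ∀ b x → (if b then 0# else x) ≈ whenNot b ⊗ x
    if≈whenNot⊗ true x = sym (zeroˡ x)
    if≈whenNot⊗ false x = sym (*-identityˡ x)
    term : ∀ π → (if pickable k π then 0# else pow θ (inv π)) ≈ whenNot (pickableCode k (code π)) ⊗ pow θ (inv π)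
    term π rewrite pickable≡pickableCode k π = if≈whenNot⊗ (pickableCode k (code π)) (pow θ (inv π))

  T2-diagonal : ∀ k → T2 θ k k ≈ Pfact θ k
  T2-diagonal k = begin
      T2 θ k k
    ≈⟨ T2≈codeSum k k ⟩
      codeSum k (λ c → whenNot (pickableCode k c))
    ≈⟨ codeSum-cong k (λ c ∣c∣≡k →
         reflexive (≡.cong whenNot (pickableCode-short k c (ℕ.≤-reflexive ∣c∣≡k)))) ⟩
      codeSum k (λ _ → 1#)
    ≈⟨ codeSum-1# k ⟩
      Pfact θ k
    ∎

  crossingWeight : ℕ → List Bool → Carrier
  crossingWeight n bs = if ⌊ countTrue bs ≟ n ⌋ then pow θ (crossings bs) else 0#

  if-suc≟suc : ∀ a b (x : Carrier) → (if ⌊ suc a ≟ suc b ⌋ then x else 0#) ≡ (if ⌊ a ≟ b ⌋ then x else 0#)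
  if-suc≟suc a b x = ≡.cong (λ t → if t then x else 0#) (does-suc≟suc a b)

  ∑-bools-suc : ∀ L g →
                ∑ (bools (suc L)) g ≈ (∑[ bs ← bools L ] g (true ∷ bs)) ⊕ (∑[ bs ← bools L ] g (false ∷ bs))
  ∑-bools-suc L g = trans (∑-++ (map (true ∷_) (bools L)) _ g)
                         (+-cong (reflexive (∑-map (true ∷_) (bools L) g)) (reflexive (∑-map (false ∷_) (bools L) g)))

  ∑-bools-∷ʳ : ∀ L g → ∑ (bools (suc L)) g ≈ ∑[ bs ← bools L ] (g (bs ++ true ∷ []) ⊕ g (bs ++ false ∷ []))
  ∑-bools-∷ʳ zero g = trans (+-cong refl (+-identityʳ _)) (sym (+-identityʳ _))
  ∑-bools-∷ʳ (suc L) g = begin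
      ∑ (bools (suc (suc L))) g
    ≈⟨ ∑-bools-suc (suc L) g ⟩
      (∑[ bs ← bools (suc L) ] g (true ∷ bs)) ⊕ (∑[ bs ← bools (suc L) ] g (false ∷ bs))
    ≈⟨ +-cong (∑-bools-∷ʳ L (λ bs → g (true ∷ bs))) (∑-bools-∷ʳ L (λ bs → g (false ∷ bs))) ⟩
      (∑[ bs ← bools L ] (g (true ∷ bs ++ true ∷ []) ⊕ g (true ∷ bs ++ false ∷ [])))
        ⊕ (∑[ bs ← bools L ] (g (false ∷ bs ++ true ∷ []) ⊕ g (false ∷ bs ++ false ∷ [])))
    ≈⟨ sym (∑-bools-suc L (λ bs → g (bs ++ true ∷ []) ⊕ g (bs ++ false ∷ []))) ⟩
      ∑[ bs ← bools (suc L) ] (g (bs ++ true ∷ []) ⊕ g (bs ++ false ∷ []))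
    ∎

  ∑-bools-tooManyTrue : ∀ L n (w : List Bool → Carrier) → L < n →
                        ∑[ bs ← bools L ] (if ⌊ countTrue bs ≟ n ⌋ then w bs else 0#) ≈ 0#
  ∑-bools-tooManyTrue zero (suc n) w _ = +-identityˡ _
  ∑-bools-tooManyTrue (suc L) (suc n) w (s≤s L<n) = begin
      ∑[ bs ← bools (suc L) ] (if ⌊ countTrue bs ≟ suc n ⌋ then w bs else 0#)
    ≈⟨ ∑-bools-suc L _ ⟩
      (∑[ bs ← bools L ] (if ⌊ suc (countTrue bs) ≟ suc n ⌋ then w (true ∷ bs) else 0#))
        ⊕ (∑[ bs ← bools L ] (if ⌊ countTrue bs ≟ suc n ⌋ then w (false ∷ bs) else 0#))
    ≈⟨ +-cong (trans (∑-cong (bools L) (λ bs → reflexive (if-suc≟suc (countTrue bs) n _)))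
                     (∑-bools-tooManyTrue L n (λ bs → w (true ∷ bs)) L<n))
              (∑-bools-tooManyTrue L (suc n) (λ bs → w (false ∷ bs)) (ℕ.m<n⇒m<1+n L<n)) ⟩
      0# ⊕ 0#
    ≈⟨ +-identityˡ 0# ⟩
      0#
    ∎

  ∑-bools-allTrue : ∀ L → ∑ (bools L) (crossingWeight L) ≈ 1#
  ∑-bools-allTrue zero = +-identityʳ _
  ∑-bools-allTrue (suc L) = begin
      ∑ (bools (suc L)) (crossingWeight (suc L))
    ≈⟨ ∑-bools-suc L (crossingWeight (suc L)) ⟩
      (∑[ bs ← bools L ] crossingWeight (suc L) (true ∷ bs)) ⊕ (∑[ bs ← bools L ] crossingWeight (suc L) (false ∷ bs))
    ≈⟨ +-cong (trans (∑-cong (bools L) (λ bs → reflexive (if-suc≟suc (countTrue bs) L _))) (∑-bools-allTrue L))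
              (∑-bools-tooManyTrue L (suc L) (λ bs → pow θ (crossings (false ∷ bs))) ℕ.≤-refl) ⟩
      1# ⊕ 0#
    ≈⟨ +-identityʳ 1# ⟩
      1#
    ∎

  B-zeroʳ : ∀ r → B θ r 0 ≈ 1#
  B-zeroʳ r = trans (reflexive (≡.cong (λ L → ∑ (bools L) (crossingWeight r)) (ℕ.+-identityʳ r))) (∑-bools-allTrue r)

  B-zeroˡ : ∀ m → B θ 0 m ≈ 1#
  B-zeroˡ zero = +-identityʳ _
  B-zeroˡ (suc m) = begin
      B θ 0 (suc m)
    ≈⟨ ∑-bools-suc m (crossingWeight 0) ⟩
      (∑[ bs ← bools m ] 0#) ⊕ (∑[ bs ← bools m ] crossingWeight 0 (false ∷ bs))
    ≈⟨ +-cong (∑-zero (bools m)) (trans (∑-cong (bools m) crossingWeight₀-false) (B-zeroˡ m)) ⟩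
      0# ⊕ 1#
    ≈⟨ +-identityˡ 1# ⟩
      1#
    ∎
    where
    crossingWeight₀-false : ∀ bs → crossingWeight 0 (false ∷ bs) ≈ crossingWeight 0 bs
    crossingWeight₀-false bs with countTrue bs
    ... | zero = refl
    ... | suc _ = refl

  -- Split on the last bit: the largest element either lies in Π₂ or lies in Π₁ and exceeds all of Π₂.
  B-suc-suc : ∀ r m → B θ (suc r) (suc m) ≈ B θ (suc r) m ⊕ pow θ (suc m) ⊗ B θ r (suc m)
  B-suc-suc r m = begin
      ∑ (bools (suc (r + suc m))) (crossingWeight (suc r))
    ≈⟨ ∑-bools-∷ʳ (r + suc m) (crossingWeight (suc r)) ⟩
      ∑[ bs ← bools (r + suc m) ] (crossingWeight (suc r) (bs ++ true ∷ []) ⊕ crossingWeight (suc r) (bs ++ false ∷ []))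
    ≈⟨ trans (∑-⊕ (bools (r + suc m)) _ _) (+-comm _ _) ⟩
      (∑[ bs ← bools (r + suc m) ] crossingWeight (suc r) (bs ++ false ∷ []))
        ⊕ (∑[ bs ← bools (r + suc m) ] crossingWeight (suc r) (bs ++ true ∷ []))
    ≈⟨ +-cong (trans (∑-cong (bools (r + suc m)) lastFalse)
                     (reflexive (≡.cong (λ L → ∑ (bools L) (crossingWeight (suc r))) (ℕ.+-suc r m))))
              (trans (∑-congᴬ (All-map (λ {bs} → lastTrue bs) (bools-length (r + suc m))))
                     (∑-distribˡ (bools (r + suc m)) (pow θ (suc m)) (crossingWeight r))) ⟩
      B θ (suc r) m ⊕ pow θ (suc m) ⊗ B θ r (suc m)
    ∎
    where
    lastFalse : ∀ bs → crossingWeight (suc r) (bs ++ false ∷ []) ≈ crossingWeight (suc r) bs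
    lastFalse bs = reflexive (≡.cong₂ (λ t x → if ⌊ t ≟ suc r ⌋ then pow θ x else 0#)
                                      (countTrue-∷ʳ-false bs) (crossings-∷ʳ-false bs))
    lastTrue : ∀ bs → length bs ≡ r + suc m →
               crossingWeight (suc r) (bs ++ true ∷ []) ≈ pow θ (suc m) ⊗ crossingWeight r bs
    lastTrue bs ∣bs∣≡ = trans (reflexive (≡.trans moveLast (if-suc≟suc (countTrue bs) r _))) (weigh (countTrue bs ≟ r))
      where
      moveLast : crossingWeight (suc r) (bs ++ true ∷ [])
                   ≡ (if ⌊ suc (countTrue bs) ≟ suc r ⌋ then pow θ (crossings bs + countFalse bs) else 0#)
      moveLast = ≡.cong₂ (λ t x → if ⌊ t ≟ suc r ⌋ then pow θ x else 0#)
                         (countTrue-∷ʳ-true bs) (crossings-∷ʳ-true bs)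
      weigh : (d : Dec (countTrue bs ≡ r)) →
              (if ⌊ d ⌋ then pow θ (crossings bs + countFalse bs) else 0#)
                ≈ pow θ (suc m) ⊗ (if ⌊ d ⌋ then pow θ (crossings bs) else 0#)
      weigh (no _) = sym (zeroʳ _)
      weigh (yes trues≡r) = trans (reflexive (≡.cong (λ x → pow θ (crossings bs + x)) countFalse≡))
                                  (trans (pow-+ (crossings bs) (suc m)) (*-comm _ _))
        where
        countFalse≡ : countFalse bs ≡ suc m
        countFalse≡ = ℕ.+-cancelˡ-≡ r _ _
          (≡.trans (≡.cong (_+ countFalse bs) (≡.sym trues≡r)) (≡.trans (countTrue+countFalse bs) ∣bs∣≡))

  codeSum-take : ∀ r f → codeSum r (λ c → f (take r c)) ≈ codeSum r f
  codeSum-take r f = codeSum-cong r (λ c ∣c∣≡r → reflexive (≡.cong f (take-all r c (ℕ.≤-reflexive ∣c∣≡r))))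

  codeSum-prefix : ∀ m r f → codeSum (r + m) (λ c → f (take r c)) ≈ B θ r m ⊗ Pfact θ m ⊗ codeSum r f
  codeSum-prefix zero r f = begin
      codeSum (r + 0) (λ c → f (take r c))
    ≈⟨ reflexive (≡.cong (λ n → codeSum n (λ c → f (take r c))) (ℕ.+-identityʳ r)) ⟩
      codeSum r (λ c → f (take r c))
    ≈⟨ codeSum-take r f ⟩
      codeSum r f
    ≈⟨ sym (trans (*-cong (trans (*-identityʳ _) (B-zeroʳ r)) refl) (*-identityˡ _)) ⟩
      B θ r 0 ⊗ Pfact θ 0 ⊗ codeSum r f
    ∎
  codeSum-prefix (suc m) zero f = begin
      codeSum (suc m) (λ _ → f [])
    ≈⟨ codeSum-const (suc m) (f []) ⟩
      f [] ⊗ Pfact θ (suc m)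
    ≈⟨ sym (trans (*-cong (trans (*-cong (B-zeroˡ (suc m)) refl) (*-identityˡ _)) (codeSum-zero f)) (*-comm _ _)) ⟩
      B θ 0 (suc m) ⊗ Pfact θ (suc m) ⊗ codeSum 0 f
    ∎
  codeSum-prefix (suc m) (suc r) f = begin
      codeSum (suc r + suc m) F
    ≈⟨ codeSum-suc (r + suc m) F ⟩
      ∑< (suc r + suc m) T
    ≈⟨ ∑<-+ (suc r) (suc m) T ⟩
      ∑< (suc r) T ⊕ (∑[ j < suc m ] T (suc r + j))
    ≈⟨ +-cong (∑<-cong (suc r) maxInPrefix) (∑<-cong (suc m) maxInSuffix) ⟩
      (∑[ q < suc r ] K ⊗ (pow θ (r ∸ q) ⊗ Y q)) ⊕ (∑[ j < suc m ] Z′ ⊗ pow θ (m ∸ j))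
    ≈⟨ +-cong (∑<-distribˡ (suc r) K (λ q → pow θ (r ∸ q) ⊗ Y q))
              (∑<-distribˡ (suc m) Z′ (λ j → pow θ (m ∸ j))) ⟩
      K ⊗ (∑[ q < suc r ] pow θ (r ∸ q) ⊗ Y q) ⊕ Z′ ⊗ (∑[ j < suc m ] pow θ (m ∸ j))
    ≈⟨ +-cong (*-cong refl (sym (codeSum-suc r f))) (*-cong (codeSum-prefix m (suc r) f) (∑<-pow-∸ m)) ⟩
      K ⊗ W ⊕ B θ (suc r) m ⊗ Pfact θ m ⊗ W ⊗ P θ (suc m)
    ≈⟨ solve 6 (λ a b p g c w → a :* b :* (p :* g) :* w :+ c :* g :* w :* p := (c :+ a :* b) :* (p :* g) :* w) refl
             (pow θ (suc m)) (B θ r (suc m)) (P θ (suc m)) (Pfact θ m) (B θ (suc r) m) W ⟩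
      (B θ (suc r) m ⊕ pow θ (suc m) ⊗ B θ r (suc m)) ⊗ Pfact θ (suc m) ⊗ W
    ≈⟨ *-cong (*-cong (sym (B-suc-suc r m)) refl) refl ⟩
      B θ (suc r) (suc m) ⊗ Pfact θ (suc m) ⊗ W
    ∎
    where
    F : List ℕ → Carrier
    F c = f (take (suc r) c)
    T : ℕ → Carrier
    T q = pow θ (r + suc m ∸ q) ⊗ codeSum (r + suc m) (λ c → F (insertMaxCode q c))
    Y : ℕ → Carrier
    Y q = codeSum r (λ c → f (insertMaxCode q c))
    K W Z′ : Carrier
    K = pow θ (suc m) ⊗ B θ r (suc m) ⊗ Pfact θ (suc m)
    W = codeSum (suc r) f
    Z′ = codeSum (suc r + m) F
    maxInPrefix : ∀ q → q < suc r → T q ≈ K ⊗ (pow θ (r ∸ q) ⊗ Y q)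
    maxInPrefix q (s≤s q≤r) = begin
        T q
      ≈⟨ *-cong (reflexive (≡.cong (pow θ) exponent))
                (codeSum-cong (r + suc m) (λ c _ → reflexive (≡.cong f (take-insertMaxCode q r c q≤r)))) ⟩
        pow θ (suc m + (r ∸ q)) ⊗ codeSum (r + suc m) (λ c → f (insertMaxCode q (take r c)))
      ≈⟨ *-cong (pow-+ (suc m) (r ∸ q)) (codeSum-prefix (suc m) r (λ c → f (insertMaxCode q c))) ⟩
        pow θ (suc m) ⊗ pow θ (r ∸ q) ⊗ (B θ r (suc m) ⊗ Pfact θ (suc m) ⊗ Y q)
      ≈⟨ solve 5 (λ a b c d e → a :* b :* (c :* d :* e) := a :* c :* d :* (b :* e)) refl _ _ _ _ _ ⟩
        K ⊗ (pow θ (r ∸ q) ⊗ Y q)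
      ∎
      where
      exponent : r + suc m ∸ q ≡ suc m + (r ∸ q)
      exponent = ≡.trans (ℕ.+-∸-comm (suc m) q≤r) (ℕ.+-comm (r ∸ q) (suc m))
    maxInSuffix : ∀ j → j < suc m → T (suc r + j) ≈ Z′ ⊗ pow θ (m ∸ j)
    maxInSuffix j (s≤s j≤m) =
      trans (*-cong (reflexive (≡.cong (pow θ) exponent)) (trans (codeSum-cong (r + suc m) prefixKept) reindex))
            (*-comm _ _)
      where
      exponent : r + suc m ∸ (suc r + j) ≡ m ∸ j
      exponent = ≡.trans (≡.cong (_∸ (suc r + j)) (ℕ.+-suc r m)) (ℕ.[m+n]∸[m+o]≡n∸o (suc r) m j)
      prefixKept : ∀ c → length c ≡ r + suc m → F (insertMaxCode (suc r + j) c) ≈ F c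
      prefixKept c ∣c∣≡ = reflexive (≡.cong f (take-insertMaxCode-prefix (suc r) (suc r + j) c (ℕ.m≤m+n (suc r) j)
                            (≡.subst (suc r + j ≤_) (≡.sym (≡.trans ∣c∣≡ (ℕ.+-suc r m))) (ℕ.+-monoʳ-≤ (suc r) j≤m))))
      reindex : codeSum (r + suc m) F ≈ Z′
      reindex = reflexive (≡.cong (λ n → codeSum n F) (ℕ.+-suc r m))

  codeSum-noRecordAfter : ∀ k n → k ≤ suc n →
                          codeSum (suc n) (λ c → whenNot (recordAfter k c)) ≈ pow θ (suc n ∸ k) ⊗ P θ k ⊗ Pfact θ n
  codeSum-noRecordAfter k n k≤1+n = begin
      codeSum (suc n) (λ c → whenNot (recordAfter k c))
    ≈⟨ codeSum-suc n (λ c → whenNot (recordAfter k c)) ⟩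
      ∑< (suc n) T
    ≈⟨ ∑<-vanish T k≤1+n maxAfter ⟩
      ∑< k T
    ≈⟨ ∑<-cong k maxBefore ⟩
      ∑[ q < k ] Pfact θ n ⊗ pow θ (suc n ∸ k + (k ∸ suc q))
    ≈⟨ trans (∑<-distribˡ k (Pfact θ n) _) (*-cong refl (∑<-pow (suc n ∸ k) k)) ⟩
      Pfact θ n ⊗ (pow θ (suc n ∸ k) ⊗ P θ k)
    ≈⟨ *-comm _ _ ⟩
      pow θ (suc n ∸ k) ⊗ P θ k ⊗ Pfact θ n
    ∎
    where
    T : ℕ → Carrier
    T q = pow θ (n ∸ q) ⊗ codeSum n (λ c → whenNot (recordAfter k (insertMaxCode q c)))
    maxBefore : ∀ q → q < k → T q ≈ Pfact θ n ⊗ pow θ (suc n ∸ k + (k ∸ suc q))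
    maxBefore q q<k =
      trans (*-cong (reflexive (≡.cong (pow θ) (∸-split q<k k≤1+n))) (trans noRecord (codeSum-1# n))) (*-comm _ _)
      where
      noRecord : codeSum n (λ c → whenNot (recordAfter k (insertMaxCode q c))) ≈ codeSum n (λ _ → 1#)
      noRecord = codeSum-cong n (λ c _ → reflexive (≡.cong whenNot (recordAfter-insertMaxCode-before q k c q<k)))
    maxAfter : ∀ q → k ≤ q → q < suc n → T q ≈ 0#
    maxAfter q k≤q (s≤s q≤n) = trans (*-cong refl (trans recordLate (codeSum-0# n))) (zeroʳ _)
      where
      recordLate : codeSum n (λ c → whenNot (recordAfter k (insertMaxCode q c))) ≈ codeSum n (λ _ → 0#)
      recordLate = codeSum-cong n (λ c ∣c∣≡n →
        reflexive (≡.cong whenNot (recordAfter-insertMaxCode-after k q c k≤q (≡.subst (q ≤_) (≡.sym ∣c∣≡n) q≤n))))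

  codeSum-prefix-noRecordAfter : ∀ q n f → q ≤ n →
    codeSum (suc n) (λ c → f (take (suc q) c) ⊗ whenNot (recordAfter (suc q) c))
      ≈ pow θ (n ∸ q) ⊗ B θ q (n ∸ q) ⊗ Pfact θ (n ∸ q) ⊗ codeSum (suc q) f
  codeSum-prefix-noRecordAfter q n f q≤n = begin
      codeSum (suc n) G
    ≈⟨ codeSum-suc n G ⟩
      ∑< (suc n) T
    ≈⟨ ∑<-vanish T (s≤s q≤n) maxAfter ⟩
      ∑< (suc q) T
    ≈⟨ ∑<-cong (suc q) maxBefore ⟩
      ∑[ q′ < suc q ] K ⊗ (pow θ (q ∸ q′) ⊗ Y q′)
    ≈⟨ ∑<-distribˡ (suc q) K (λ q′ → pow θ (q ∸ q′) ⊗ Y q′) ⟩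
      K ⊗ (∑[ q′ < suc q ] pow θ (q ∸ q′) ⊗ Y q′)
    ≈⟨ *-cong refl (sym (codeSum-suc q f)) ⟩
      K ⊗ codeSum (suc q) f
    ∎
    where
    d : ℕ
    d = n ∸ q
    G : List ℕ → Carrier
    G c = f (take (suc q) c) ⊗ whenNot (recordAfter (suc q) c)
    T Y : ℕ → Carrier
    T q′ = pow θ (n ∸ q′) ⊗ codeSum n (λ c → G (insertMaxCode q′ c))
    Y q′ = codeSum q (λ c → f (insertMaxCode q′ c))
    K : Carrier
    K = pow θ d ⊗ B θ q d ⊗ Pfact θ d
    maxBefore : ∀ q′ → q′ < suc q → T q′ ≈ K ⊗ (pow θ (q ∸ q′) ⊗ Y q′)
    maxBefore q′ (s≤s q′≤q) = begin
        T q′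
      ≈⟨ *-cong (reflexive (≡.cong (pow θ) (∸-split q′≤q q≤n))) (codeSum-cong n noRecord) ⟩
        pow θ (d + (q ∸ q′)) ⊗ codeSum n (λ c → f (insertMaxCode q′ (take q c)))
      ≈⟨ *-cong (pow-+ d (q ∸ q′))
                (reflexive (≡.cong (λ m → codeSum m (λ c → f (insertMaxCode q′ (take q c)))) (≡.sym (ℕ.m+[n∸m]≡n q≤n)))) ⟩
        pow θ d ⊗ pow θ (q ∸ q′) ⊗ codeSum (q + d) (λ c → f (insertMaxCode q′ (take q c)))
      ≈⟨ *-cong refl (codeSum-prefix d q (λ c → f (insertMaxCode q′ c))) ⟩
        pow θ d ⊗ pow θ (q ∸ q′) ⊗ (B θ q d ⊗ Pfact θ d ⊗ Y q′)
      ≈⟨ solve 5 (λ a b c e g → a :* b :* (c :* e :* g) := a :* c :* e :* (b :* g)) refl _ _ _ _ _ ⟩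
        K ⊗ (pow θ (q ∸ q′) ⊗ Y q′)
      ∎
      where
      noRecord : ∀ c → length c ≡ n → G (insertMaxCode q′ c) ≈ f (insertMaxCode q′ (take q c))
      noRecord c _ = trans (reflexive (≡.cong₂ (λ p b → f p ⊗ whenNot b) (take-insertMaxCode q′ q c q′≤q)
                                                (recordAfter-insertMaxCode-before q′ (suc q) c (s≤s q′≤q))))
                           (*-identityʳ _)
    maxAfter : ∀ q′ → suc q ≤ q′ → q′ < suc n → T q′ ≈ 0#
    maxAfter q′ q<q′ (s≤s q′≤n) = trans (*-cong refl (trans (codeSum-cong n recordLate) (codeSum-0# n))) (zeroʳ _)
      where
      recordLate : ∀ c → length c ≡ n → G (insertMaxCode q′ c) ≈ 0#
      recordLate c ∣c∣≡n = trans (*-cong refl (reflexive (≡.cong whenNot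
        (recordAfter-insertMaxCode-after (suc q) q′ c q<q′ (≡.subst (q′ ≤_) (≡.sym ∣c∣≡n) q′≤n))))) (zeroʳ _)

  unpickableMaxAt : ℕ → ℕ → ℕ → Carrier
  unpickableMaxAt k n q = pow θ (n ∸ q) ⊗ codeSum n (λ c → whenNot (pickableCode k (insertMaxCode q c)))

  T2-suc : ∀ n k → T2 θ (suc n) k ≈ ∑< (suc n) (unpickableMaxAt k n)
  T2-suc n k = trans (T2≈codeSum (suc n) k) (codeSum-suc n (λ c → whenNot (pickableCode k c)))

  unpickableMaxAt-early : ∀ k n q → q ≤ k → k ≤ n →
    unpickableMaxAt (suc k) (suc n) q ≈ pow θ (suc n ∸ k) ⊗ P θ k ⊗ Pfact θ n ⊗ pow θ (suc n ∸ k + (suc k ∸ suc q))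
  unpickableMaxAt-early k n q q≤k k≤n = trans (*-comm _ _) (*-cong noRecordAfter (reflexive (≡.cong (pow θ) exponent)))
    where
    exponent : suc n ∸ q ≡ suc n ∸ k + (suc k ∸ suc q)
    exponent = ∸-split (s≤s q≤k) (s≤s (ℕ.m≤n⇒m≤1+n k≤n))
    noRecordAfter : codeSum (suc n) (λ c → whenNot (pickableCode (suc k) (insertMaxCode q c))) ≈ pow θ (suc n ∸ k) ⊗ P θ k ⊗ Pfact θ n
    noRecordAfter =
      trans (codeSum-cong (suc n) (λ c _ → reflexive (≡.cong whenNot (pickableCode-insertMaxCode-early q k c q≤k))))
            (codeSum-noRecordAfter k n (ℕ.m≤n⇒m≤1+n k≤n))

  recurrenceTerm : ℕ → ℕ → ℕ → Carrier
  recurrenceTerm N k i = pow θ (2 * N ∸ 2 * i) ⊗ B θ (i ∸ 2) (N ∸ i) ⊗ T2 θ (i ∸ 1) k ⊗ Pfact θ (N ∸ i)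

  unpickableMaxAt-late : ∀ k n q → k ≤ q → q ≤ n →
                         unpickableMaxAt (suc k) (suc n) (suc q) ≈ recurrenceTerm (suc (suc n)) (suc k) (suc (suc q))
  unpickableMaxAt-late k n q k≤q q≤n = begin
      unpickableMaxAt (suc k) (suc n) (suc q)
    ≈⟨ *-cong refl (codeSum-cong (suc n) splitPickable) ⟩
      pow θ d ⊗ codeSum (suc n) (λ c → G (take (suc q) c) ⊗ whenNot (recordAfter (suc q) c))
    ≈⟨ *-cong refl (codeSum-prefix-noRecordAfter q n G q≤n) ⟩
      pow θ d ⊗ (pow θ d ⊗ B θ q d ⊗ Pfact θ d ⊗ codeSum (suc q) G)
    ≈⟨ *-cong refl (*-cong refl (sym (T2≈codeSum (suc q) (suc k)))) ⟩
      pow θ d ⊗ (pow θ d ⊗ B θ q d ⊗ Pfact θ d ⊗ T2 θ (suc q) (suc k))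
    ≈⟨ solve 5 (λ a a′ b f t → a :* (a′ :* b :* f :* t) := a :* a′ :* b :* t :* f) refl _ _ _ _ _ ⟩
      pow θ d ⊗ pow θ d ⊗ B θ q d ⊗ T2 θ (suc q) (suc k) ⊗ Pfact θ d
    ≈⟨ *-cong (*-cong (*-cong (sym (pow-2*∸2* (suc (suc n)) (suc (suc q)))) refl) refl) refl ⟩
      recurrenceTerm (suc (suc n)) (suc k) (suc (suc q))
    ∎
    where
    d : ℕ
    d = n ∸ q
    G : List ℕ → Carrier
    G c = whenNot (pickableCode (suc k) c)
    splitPickable : ∀ c → length c ≡ suc n →
                    G (insertMaxCode (suc q) c) ≈ G (take (suc q) c) ⊗ whenNot (recordAfter (suc q) c)
    splitPickable c ∣c∣≡ = trans (reflexive (≡.cong whenNot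
      (pickableCode-insertMaxCode-late (suc k) (suc q) c (s≤s k≤q) (≡.subst (suc q ≤_) (≡.sym ∣c∣≡) (s≤s q≤n)))))
      (whenNot-∨ _ _)

  T2-recurrence : ∀ k n → k ≤ n →
    T2 θ (suc (suc n)) (suc k) ≈ pow θ (2 * suc (suc n) ∸ 2 * suc k) ⊗ P θ (suc k) ⊗ P θ k ⊗ Pfact θ n
                                 ⊕ (∑[ j < suc n ∸ k ] recurrenceTerm (suc (suc n)) (suc k) (suc (suc k + j)))
  T2-recurrence k n k≤n = begin
      T2 θ (suc (suc n)) (suc k)
    ≈⟨ T2-suc (suc n) (suc k) ⟩
      ∑< (suc (suc n)) T
    ≈⟨ ∑<-split T (s≤s (ℕ.m≤n⇒m≤1+n k≤n)) ⟩
      ∑< (suc k) T ⊕ (∑[ j < suc n ∸ k ] T (suc k + j))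
    ≈⟨ +-cong maxEarly (∑<-cong (suc n ∸ k) maxLate) ⟩
      pow θ (2 * suc (suc n) ∸ 2 * suc k) ⊗ P θ (suc k) ⊗ P θ k ⊗ Pfact θ n
        ⊕ (∑[ j < suc n ∸ k ] recurrenceTerm (suc (suc n)) (suc k) (suc (suc k + j)))
    ∎
    where
    T : ℕ → Carrier
    T = unpickableMaxAt (suc k) (suc n)
    e : ℕ
    e = suc n ∸ k
    maxEarly : ∑< (suc k) T ≈ pow θ (2 * suc (suc n) ∸ 2 * suc k) ⊗ P θ (suc k) ⊗ P θ k ⊗ Pfact θ n
    maxEarly = begin
        ∑< (suc k) T
      ≈⟨ ∑<-cong (suc k) (λ q q<1+k → unpickableMaxAt-early k n q (ℕ.≤-pred q<1+k) k≤n) ⟩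
        ∑[ q < suc k ] pow θ e ⊗ P θ k ⊗ Pfact θ n ⊗ pow θ (e + (suc k ∸ suc q))
      ≈⟨ trans (∑<-distribˡ (suc k) _ (λ q → pow θ (e + (suc k ∸ suc q)))) (*-cong refl (∑<-pow e (suc k))) ⟩
        pow θ e ⊗ P θ k ⊗ Pfact θ n ⊗ (pow θ e ⊗ P θ (suc k))
      ≈⟨ solve 5 (λ a b c a′ p → a :* b :* c :* (a′ :* p) := a :* a′ :* p :* b :* c) refl _ _ _ _ _ ⟩
        pow θ e ⊗ pow θ e ⊗ P θ (suc k) ⊗ P θ k ⊗ Pfact θ n
      ≈⟨ *-cong (*-cong (*-cong (sym (pow-2*∸2* (suc (suc n)) (suc k))) refl) refl) refl ⟩
        pow θ (2 * suc (suc n) ∸ 2 * suc k) ⊗ P θ (suc k) ⊗ P θ k ⊗ Pfact θ n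
      ∎
    maxLate : ∀ j → j < suc n ∸ k → T (suc k + j) ≈ recurrenceTerm (suc (suc n)) (suc k) (suc (suc k + j))
    maxLate j j< = unpickableMaxAt-late k n (k + j) (ℕ.m≤m+n k j) (ℕ.≤-pred (j<n∸m⇒m+j<n j (ℕ.m≤n⇒m≤1+n k≤n) j<))

  ∑-range : ∀ g lo hi → sumL (map g (range lo hi)) ≡ ∑[ j < suc hi ∸ lo ] g (lo + j)
  ∑-range g lo hi = ≡.cong sumL (≡.trans (≡.cong (map g) (map-applyUpTo (λ j → j) (lo +_) (suc hi ∸ lo)))
                                         (map-applyUpTo (lo +_) g (suc hi ∸ lo)))

  ∑-range-suc : ∀ g k N → sumL (map g (range (k + 1) N)) ≡ ∑[ j < N ∸ k ] g (suc (k + j))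
  ∑-range-suc g k N rewrite ℕ.+-comm k 1 = ∑-range g (suc k) N

lemma7 : ∀ {c ℓ} (R : CommutativeSemiring c ℓ) (θ : CommutativeSemiring.Carrier R) (k N : ℕ) →
         1 ≤ k → k + 1 ≤ N →
         let open WithSemiring R in (T2 θ N k ≈ (pow θ (2 * N ∸ 2 * k) ⊗ P θ k ⊗ P θ (k ∸ 1) ⊗ Pfact θ (N ∸ 2)
                         ⊕ sumL (map (λ i → pow θ (2 * N ∸ 2 * i) ⊗ B θ (i ∸ 2) (N ∸ i)
                                             ⊗ T2 θ (i ∸ 1) k ⊗ Pfact θ (N ∸ i))
                                     (range (k + 1) N))))
            × (T2 θ k k ≈ Pfact θ k)
lemma7 R θ zero N () _
lemma7 R θ (suc k) zero _ ()
lemma7 R θ (suc k) (suc zero) _ (s≤s k+1≤0) = contradiction (ℕ.m+n≤o⇒n≤o k k+1≤0) λ ()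
lemma7 R θ (suc k) (suc (suc n)) _ (s≤s k+1≤1+n) =
    trans (T2-recurrence k n (ℕ.≤-pred (ℕ.≤-trans (ℕ.≤-reflexive (ℕ.+-comm 1 k)) k+1≤1+n)))
          (+-cong refl (reflexive (≡.sym (∑-range-suc (recurrenceTerm (suc (suc n)) (suc k)) (suc k) (suc (suc n))))))
  , T2-diagonal (suc k)
  where
  open WeightedSums R θ
  open CommutativeSemiring R using (refl; trans; reflexive; +-cong)
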